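{- For an integer $p \geq 0$, let $N^{\mathrm{even}}_2(3,p)$ (resp. $N^{\mathrm{odd}}_2(3,p)$) denote the maximum number of vertices of a connected subgraph $S$ of the infinite $2$-dimensional mesh such that every vertex of $S$ has degree at most $3$ in $S$ and the diameter of $S$ is at most $D = 2p$ (resp. $D = 2p+1$). Then: \begin{itemize} \item for every integer $p \geq 0$: $\;2p^2 - 2p + 1 \leq N^{\mathrm{even}}_2(3,p) \leq 2p^2 + 2p + 1$; \item if $p = 2r$ (so $D = 4r+1$) with $r \geq 0$ an integer: $\;8r^2 + 2r = 2p^2 + p \leq N^{\mathrm{odd}}_2(3,p) \leq 2p^2 + 4p + 2$; \item if $p = 2r+1$ (so $D = 4r+3$) with $r \geq 0$ an integer: $\;8r^2 + 10r + 6 = 2p^2 + p + 3 \leq N^{\mathrm{odd}}_2(3,p) \leq 2p^2 + 4p + 2$. \end{itemize}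
   Context: The infinite $2$-dimensional mesh is the graph with vertex set $\mathbb{Z}^2$ in which two vertices are adjacent iff their $L^1$ distance is $1$. A subgraph need not be induced; the diameter of $S$ is measured with respect to distances in $S$ itself. -}

module Defs where

open import Data.Nat using (ℕ; zero; suc; _+_; _*_; _∸_; _≤_)
open import Data.Integer as ℤ using (ℤ; ∣_∣) renaming (_+_ to _+ℤ_; _-_ to _-ℤ_)
open import Data.Product using (Σ; _×_; _,_; ∃)
open import Data.Bool using (Bool; true)
open import Data.List using (List; _∷_; []; length; filterᵇ)
open import Data.List.Relation.Unary.Unique.Propositional using (Unique)
open import Data.List.Membership.Propositional using (_∈_)
open import Relation.Binary.PropositionalEquality using (_≡_)

Point : Set
Point = ℤ × ℤ

Adjacent : Point → Point → Set
Adjacent (x₁ , y₁) (x₂ , y₂) = ∣ x₁ -ℤ x₂ ∣ + ∣ y₁ -ℤ y₂ ∣ ≡ 1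

meshNeighbours : Point → List Point
meshNeighbours (x , y) =
  (x +ℤ ℤ.1ℤ , y) ∷ (x -ℤ ℤ.1ℤ , y) ∷ (x , y +ℤ ℤ.1ℤ) ∷ (x , y -ℤ ℤ.1ℤ) ∷ []

-- A (finite) subgraph of the mesh: a duplicate-free list of vertices and a
-- symmetric edge indicator whose edges are mesh edges between listed vertices.
-- (Not necessarily induced.)
record MeshSubgraph : Set where
  field
    verts     : List Point
    uniq      : Unique verts
    edge      : Point → Point → Bool
    edge-sym  : ∀ u v → edge u v ≡ edge v u
    edge-adj  : ∀ u v → edge u v ≡ true → Adjacent u v
    edge-mem  : ∀ u v → edge u v ≡ true → (u ∈ verts) × (v ∈ verts)

open MeshSubgraph public

size : MeshSubgraph → ℕ
size S = length (verts S)

degree : MeshSubgraph → Point → ℕ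
degree S v = length (filterᵇ (edge S v) (meshNeighbours v))

data Walk (S : MeshSubgraph) : Point → Point → ℕ → Set where
  here : ∀ {u} → Walk S u u 0
  step : ∀ {u w v n} → edge S u w ≡ true → Walk S w v n → Walk S u v (suc n)

MaxDegreeAtMost : MeshSubgraph → ℕ → Set
MaxDegreeAtMost S k = ∀ v → v ∈ verts S → degree S v ≤ k

Connected : MeshSubgraph → Set
Connected S = ∀ u v → u ∈ verts S → v ∈ verts S → ∃ λ n → Walk S u v n

DiameterAtMost : MeshSubgraph → ℕ → Set
DiameterAtMost S D =
  ∀ u v → u ∈ verts S → v ∈ verts S → Σ ℕ λ n → (n ≤ D) × Walk S u v n

Admissible : ℕ → MeshSubgraph → Set
Admissible D S = Connected S × MaxDegreeAtMost S 3 × DiameterAtMost S D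

-- "k ≤ N" where N is the maximum size of an admissible subgraph.
AtLeastN : ℕ → ℕ → Set
AtLeastN D k = Σ MeshSubgraph λ S → Admissible D S × (k ≤ size S)

-- "N ≤ k".
AtMostN : ℕ → ℕ → Set
AtMostN D k = ∀ S → Admissible D S → size S ≤ k

-- Upper bound.  Along a mesh edge the diagonal coordinates x + y and x − y change by at most 1,
-- so a subgraph of diameter D lies in a D × D square of diagonal coordinates.  Shifted to [0, D]²
-- its points (i , j) satisfy i + j = 2x − const, so they all lie in one parity class of the square,
-- and an explicit code injects that class into [0, M).
-- Lower bound.  A double comb: the columns x = 0 and x = 1 hang from the origin and from the hub
-- (1 , 0), joined by one edge, and each row y ≠ 0 branches to the left of column 0 and to the right
-- of column 1.  This tree has maximum degree 3; keeping the vertices within tree distance m of the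
-- origin on the left and n of the hub on the right gives 2 + m (m + 1) + n (n + 1) vertices and
-- diameter max (2m , 2n , m + n + 1).

module Submission where

open import Defs
open import Data.Nat using (ℕ; zero; suc; _+_; _*_; _∸_; _≤_; _<_; z≤n; s≤s; z<s; s<s; NonZero; ⌊_/2⌋; parity)
open import Data.Nat.Properties as ℕ using (module ≤-Reasoning)
open import Data.Nat.DivMod using (_%_; [m+kn]%n≡m%n; m<n⇒m%n≡m)
open import Data.Nat.ListAction using (sum)
open import Data.Nat.Tactic.RingSolver as ℕ-Solver using ()
open import Data.Parity.Base as ℙ using (Parity)
import Data.Parity.Properties as ℙ
open import Data.Integer as ℤ using (ℤ; +_; -[1+_]; ∣_∣)
import Data.Integer.Properties as ℤ
open import Data.Integer.Tactic.RingSolver as ℤ-Solver using ()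
open import Data.Bool using (Bool; true; false; T; T?)
import Data.Bool.Properties as Bool
open import Data.Product using (Σ; _×_; _,_; proj₁; proj₂)
open import Data.Product.Properties using (≡-dec)
open import Data.Sum as Sum using (_⊎_; inj₁; inj₂; [_,_]′)
open import Data.List using (List; []; _∷_; length; map; upTo; _++_; concat; concatMap)
open import Data.List.Properties using (filter-notAll; length-++; length-map; length-upTo; length-removeAt′)
open import Data.List.Relation.Unary.Any as Any using (here; there; _─_)
import Data.List.Relation.Unary.Any.Properties as Any
open import Data.List.Relation.Unary.All as All using ([]; _∷_)
import Data.List.Relation.Unary.All.Properties as All
import Data.List.Relation.Unary.AllPairs as AllPairs
import Data.List.Relation.Unary.AllPairs.Properties as AllPairs
open import Data.List.Relation.Unary.Unique.Propositional using (Unique; []; _∷_)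
import Data.List.Relation.Unary.Unique.Propositional.Properties as Unique
open import Data.List.Relation.Binary.Disjoint.Propositional using (Disjoint)
open import Data.List.Membership.Propositional using (_∈_)
open import Data.List.Membership.Propositional.Properties
  using (∈-upTo⁺; ∈-upTo⁻; ∈-map⁺; ∈-map⁻; ∈-++⁺ˡ; ∈-++⁺ʳ; ∈-++⁻; ∈-concat⁻; ∈-concat⁺′)
import Data.List.Membership.DecPropositional as DecMembership
import Data.List.Extrema ℤ.≤-totalOrder as ℤ-Extrema
open import Data.Empty using (⊥-elim)
open import Function using (_∘_; flip; mk⇔)
open import Relation.Binary.Definitions using (DecidableEquality)
open import Relation.Binary.PropositionalEquality
open import Relation.Nullary using (¬_; Dec; yes; does; _×-dec_; _⊎-dec_)
open import Relation.Nullary.Decidable using (dec-true; dec-false; does-⇔)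

length-concat : ∀ {A : Set} (xss : List (List A)) → length (concat xss) ≡ sum (map length xss)
length-concat [] = refl
length-concat (xs ∷ xss) = trans (length-++ xs) (cong (λ l → length xs + l) (length-concat xss))

disjoint-map : ∀ {A B C : Set} {f : A → C} {g : B → C} {xs ys} →
  (∀ a b → f a ≢ g b) → Disjoint (map f xs) (map g ys)
disjoint-map {f = f} {g} f≢g (p , q) with a , _ , refl ← ∈-map⁻ f p | b , _ , eq ← ∈-map⁻ g q =
  f≢g a b eq

∈-─⁺ : ∀ {A : Set} {x y : A} {xs} (x∈xs : x ∈ xs) → y ∈ xs → y ≢ x → y ∈ (xs ─ x∈xs)
∈-─⁺ (here refl) (here refl) y≢x = ⊥-elim (y≢x refl)
∈-─⁺ (here refl) (there y∈xs) _ = y∈xs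
∈-─⁺ (there x∈xs) (here refl) _ = here refl
∈-─⁺ (there x∈xs) (there y∈xs) y≢x = there (∈-─⁺ x∈xs y∈xs y≢x)

InjectiveOn : ∀ {A B : Set} → (A → B) → List A → Set
InjectiveOn f xs = ∀ {x y} → x ∈ xs → y ∈ xs → f x ≡ f y → x ≡ y

injection⇒length-≤ : ∀ {A B : Set} (f : A → B) {xs ys} → Unique xs →
  (∀ {x} → x ∈ xs → f x ∈ ys) → InjectiveOn f xs → length xs ≤ length ys
injection⇒length-≤ f {[]} _ _ _ = z≤n
injection⇒length-≤ f {x ∷ xs} {ys} (x∉xs ∷ uniq) into inj =
  subst (suc (length xs) ≤_) (sym (length-removeAt′ ys _))
    (s≤s (injection⇒length-≤ f uniq into′ (λ p q → inj (there p) (there q))))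
  where
  fx∈ys = into (here refl)
  into′ : ∀ {y} → y ∈ xs → f y ∈ (ys ─ fx∈ys)
  into′ y∈xs = ∈-─⁺ fx∈ys (into (there y∈xs))
    (λ fy≡fx → All.lookup x∉xs y∈xs (sym (inj (there y∈xs) (here refl) fy≡fx)))

injectionBelow⇒length-≤ : ∀ {A : Set} (f : A → ℕ) {xs} M → Unique xs →
  (∀ {x} → x ∈ xs → f x < M) → InjectiveOn f xs → length xs ≤ M
injectionBelow⇒length-≤ f M uniq below inj =
  subst (_ ≤_) (length-upTo M) (injection⇒length-≤ f uniq (∈-upTo⁺ ∘ below) inj)

-- Parity classes of a square

*+-injective : ∀ K {i j k l} .{{_ : NonZero K}} → j < K → l < K →
  i * K + j ≡ k * K + l → i ≡ k × j ≡ l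
*+-injective K {i} {j} {k} {l} j<K l<K eq = i≡k , j≡l
  where
  remainder : ∀ a {b} → b < K → (a * K + b) % K ≡ b
  remainder a {b} b<K =
    trans (cong (_% K) (ℕ.+-comm (a * K) b)) (trans ([m+kn]%n≡m%n b a K) (m<n⇒m%n≡m b<K))
  j≡l = trans (sym (remainder i j<K)) (trans (cong (_% K) eq) (remainder k l<K))
  i≡k = ℕ.*-cancelʳ-≡ i k K (ℕ.+-cancelʳ-≡ l (i * K) (k * K) (subst (λ b → i * K + b ≡ _) j≡l eq))

m+k≡n⇒m≤n : ∀ {m n} k → m + k ≡ n → m ≤ n
m+k≡n⇒m≤n k refl = ℕ.m≤m+n _ k

parity-⌊/2⌋-injective : ∀ {m n} → parity m ≡ parity n → ⌊ m /2⌋ ≡ ⌊ n /2⌋ → m ≡ n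
parity-⌊/2⌋-injective {0} {0} _ _ = refl
parity-⌊/2⌋-injective {1} {1} _ _ = refl
parity-⌊/2⌋-injective {suc (suc m)} {suc (suc n)} p h =
  cong (suc ∘ suc) (parity-⌊/2⌋-injective p (ℕ.suc-injective h))
parity-⌊/2⌋-injective {0} {1} () _
parity-⌊/2⌋-injective {1} {0} () _
parity-⌊/2⌋-injective {0} {suc (suc n)} _ ()
parity-⌊/2⌋-injective {1} {suc (suc n)} _ ()
parity-⌊/2⌋-injective {suc (suc m)} {0} _ ()
parity-⌊/2⌋-injective {suc (suc m)} {1} _ ()

⌊n/2⌋<m : ∀ {n m} → n < m + m → ⌊ n /2⌋ < m
⌊n/2⌋<m {0} {suc m} _ = z<s
⌊n/2⌋<m {1} {suc m} _ = z<s
⌊n/2⌋<m {suc (suc n)} {suc m} (s<s n<) =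
  s<s (⌊n/2⌋<m (ℕ.≤-pred (subst (suc (suc n) ≤_) (ℕ.+-suc m m) n<)))

parity-+-double : ∀ n t → parity (n + (t + t)) ≡ parity n
parity-+-double n t = begin
  parity (n + (t + t))                    ≡⟨ ℙ.+-homo-+ n (t + t) ⟩
  parity n ℙ.+ parity (t + t)             ≡⟨ cong (parity n ℙ.+_) (ℙ.+-homo-+ t t) ⟩
  parity n ℙ.+ (parity t ℙ.+ parity t)    ≡⟨ cong (parity n ℙ.+_) (ℙ.p+p≡0ℙ (parity t)) ⟩
  parity n ℙ.+ ℙ.0ℙ                       ≡⟨ ℙ.+-identityʳ (parity n) ⟩
  parity n                                ∎
  where open ≡-Reasoning

parity-cong-ℤ : ∀ m n k → + m ≡ + n ℤ.+ (k ℤ.+ k) → parity m ≡ parity n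
parity-cong-ℤ m n (+ t) eq = trans (cong parity (ℤ.+-injective eq)) (parity-+-double n t)
parity-cong-ℤ m n -[1+ t ] eq =
  sym (parity-cong-ℤ n m (+ suc t) (trans (swap (+ n) -[1+ t ]) (cong (ℤ._+ _) (sym eq))))
  where
  swap : ∀ i k → i ≡ (i ℤ.+ (k ℤ.+ k)) ℤ.+ (ℤ.- k ℤ.+ ℤ.- k)
  swap = ℤ-Solver.solve-∀

ParityBox : ℕ → Parity → ℕ × ℕ → Set
ParityBox D c (i , j) = i ≤ D × j ≤ D × parity (i + j) ≡ c

record BoxEncoding (D M : ℕ) : Set where
  field
    code           : ℕ × ℕ → ℕ
    code-<         : ∀ {c ij} → ParityBox D c ij → code ij < M
    code-injective : ∀ {c ij kl} → ParityBox D c ij → ParityBox D c kl → code ij ≡ code kl → ij ≡ kl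

-- Since 2p + 1 is odd, i (2p + 1) + j has the parity of i + j, so halving it is injective
-- on a parity class.
evenBoxEncoding : ∀ p → BoxEncoding (2 * p) (2 * p * p + 2 * p + 1)
evenBoxEncoding p = record { code = ⌊_/2⌋ ∘ N ; code-< = code-< ; code-injective = code-injective }
  where
  N : ℕ × ℕ → ℕ
  N (i , j) = i * suc (2 * p) + j

  N-bound : suc (2 * p * suc (2 * p) + 2 * p) ≤ (2 * p * p + 2 * p + 1) + (2 * p * p + 2 * p + 1)
  N-bound = m+k≡n⇒m≤n 1 (identity p)
    where
    identity : ∀ p → suc (2 * p * suc (2 * p) + 2 * p) + 1 ≡ (2 * p * p + 2 * p + 1) + (2 * p * p + 2 * p + 1)
    identity = ℕ-Solver.solve-∀

  code-< : ∀ {c ij} → ParityBox (2 * p) c ij → ⌊ N ij /2⌋ < 2 * p * p + 2 * p + 1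
  code-< (i≤ , j≤ , _) = ⌊n/2⌋<m (ℕ.≤-trans (s≤s (ℕ.+-mono-≤ (ℕ.*-monoˡ-≤ (suc (2 * p)) i≤) j≤)) N-bound)

  N-parity : ∀ i j → parity (N (i , j)) ≡ parity (i + j)
  N-parity i j = trans (cong parity (N-split i j p)) (parity-+-double (i + j) (i * p))
    where
    N-split : ∀ i j p → i * suc (2 * p) + j ≡ (i + j) + (i * p + i * p)
    N-split = ℕ-Solver.solve-∀

  code-injective : ∀ {c ij kl} → ParityBox (2 * p) c ij → ParityBox (2 * p) c kl →
    ⌊ N ij /2⌋ ≡ ⌊ N kl /2⌋ → ij ≡ kl
  code-injective {ij = i , j} {k , l} (_ , j≤ , cᵢⱼ) (_ , l≤ , cₖₗ) h
    with refl , refl ← *+-injective (suc (2 * p)) {i} {j} {k} {l} (s≤s j≤) (s≤s l≤)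
        (parity-⌊/2⌋-injective (trans (N-parity i j) (trans cᵢⱼ (sym (trans (N-parity k l) cₖₗ)))) h)
    = refl

-- On a parity class, i fixes the parity of j, so ⌊ j /2⌋ determines j.
oddBoxEncoding : ∀ p → BoxEncoding (suc (2 * p)) (2 * p * p + 4 * p + 2)
oddBoxEncoding p = record { code = code ; code-< = code-< ; code-injective = code-injective }
  where
  code : ℕ × ℕ → ℕ
  code (i , j) = i * suc p + ⌊ j /2⌋

  half-< : ∀ {j} → j ≤ suc (2 * p) → ⌊ j /2⌋ < suc p
  half-< j≤ = ⌊n/2⌋<m (ℕ.≤-trans (s≤s j≤) (ℕ.≤-reflexive (double p)))
    where
    double : ∀ p → suc (suc (2 * p)) ≡ suc p + suc p
    double = ℕ-Solver.solve-∀

  code-< : ∀ {c ij} → ParityBox (suc (2 * p)) c ij → code ij < 2 * p * p + 4 * p + 2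
  code-< {ij = i , j} (i≤ , j≤ , _) = begin-strict
    i * suc p + ⌊ j /2⌋            <⟨ ℕ.+-mono-≤-< (ℕ.*-monoˡ-≤ (suc p) i≤) (half-< j≤) ⟩
    suc (2 * p) * suc p + suc p    ≡⟨ total p ⟩
    2 * p * p + 4 * p + 2          ∎
    where
    open ≤-Reasoning
    total : ∀ p → suc (2 * p) * suc p + suc p ≡ 2 * p * p + 4 * p + 2
    total = ℕ-Solver.solve-∀

  code-injective : ∀ {c ij kl} → ParityBox (suc (2 * p)) c ij → ParityBox (suc (2 * p)) c kl →
    code ij ≡ code kl → ij ≡ kl
  code-injective {ij = i , j} {k , l} (_ , j≤ , cᵢⱼ) (_ , l≤ , cₖₗ) h
    with refl , halves ← *+-injective (suc p) {i} {⌊ j /2⌋} {k} {⌊ l /2⌋} (half-< j≤) (half-< l≤) h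
    = cong (i ,_) (parity-⌊/2⌋-injective parities halves)
    where
    parities : parity j ≡ parity l
    parities = ℙ.+-cancelˡ-≡ (parity i) (parity j) (parity l)
      (trans (sym (ℙ.+-homo-+ i j)) (trans cᵢⱼ (trans (sym cₖₗ) (ℙ.+-homo-+ i l))))

-- Diagonal coordinates and the upper bound

diag⁺ diag⁻ : Point → ℤ
diag⁺ (x , y) = x ℤ.+ y
diag⁻ (x , y) = x ℤ.- y

diagonals-injective : ∀ {u v} → diag⁺ u ≡ diag⁺ v → diag⁻ u ≡ diag⁻ v → u ≡ v
diagonals-injective {x , y} {x′ , y′} eq⁺ eq⁻ = cong₂ _,_ x≡x′ y≡y′
  where
  double-x : ∀ x y → + 2 ℤ.* x ≡ (x ℤ.+ y) ℤ.+ (x ℤ.- y)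
  double-x = ℤ-Solver.solve-∀
  y-from : ∀ x y → y ≡ (x ℤ.+ y) ℤ.- x
  y-from = ℤ-Solver.solve-∀
  x≡x′ = ℤ.*-cancelˡ-≡ (+ 2) x x′ (trans (double-x x y) (trans (cong₂ ℤ._+_ eq⁺ eq⁻) (sym (double-x x′ y′))))
  y≡y′ = trans (y-from x y) (trans (cong₂ ℤ._-_ eq⁺ x≡x′) (sym (y-from x′ y′)))

Lipschitz : (Point → ℤ) → Set
Lipschitz F = ∀ u v → Adjacent u v → ∣ F u ℤ.- F v ∣ ≤ 1

diag⁺-lipschitz : Lipschitz diag⁺
diag⁺-lipschitz (x , y) (x′ , y′) adj = begin
  ∣ (x ℤ.+ y) ℤ.- (x′ ℤ.+ y′) ∣           ≡⟨ cong ∣_∣ (split x y x′ y′) ⟨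
  ∣ (x ℤ.- x′) ℤ.+ (y ℤ.- y′) ∣           ≤⟨ ℤ.∣i+j∣≤∣i∣+∣j∣ (x ℤ.- x′) (y ℤ.- y′) ⟩
  ∣ x ℤ.- x′ ∣ + ∣ y ℤ.- y′ ∣             ≡⟨ adj ⟩
  1                                       ∎
  where
  open ≤-Reasoning
  split : ∀ x y x′ y′ → (x ℤ.- x′) ℤ.+ (y ℤ.- y′) ≡ (x ℤ.+ y) ℤ.- (x′ ℤ.+ y′)
  split = ℤ-Solver.solve-∀

diag⁻-lipschitz : Lipschitz diag⁻
diag⁻-lipschitz (x , y) (x′ , y′) adj = begin
  ∣ (x ℤ.- y) ℤ.- (x′ ℤ.- y′) ∣           ≡⟨ cong ∣_∣ (split x y x′ y′) ⟨
  ∣ (x ℤ.- x′) ℤ.- (y ℤ.- y′) ∣           ≤⟨ ℤ.∣i-j∣≤∣i∣+∣j∣ (x ℤ.- x′) (y ℤ.- y′) ⟩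
  ∣ x ℤ.- x′ ∣ + ∣ y ℤ.- y′ ∣             ≡⟨ adj ⟩
  1                                       ∎
  where
  open ≤-Reasoning
  split : ∀ x y x′ y′ → (x ℤ.- x′) ℤ.- (y ℤ.- y′) ≡ (x ℤ.- y) ℤ.- (x′ ℤ.- y′)
  split = ℤ-Solver.solve-∀

∣i-k∣≤∣i-j∣+∣j-k∣ : ∀ i j k → ∣ i ℤ.- k ∣ ≤ ∣ i ℤ.- j ∣ + ∣ j ℤ.- k ∣
∣i-k∣≤∣i-j∣+∣j-k∣ i j k =
  subst (λ d → ∣ d ∣ ≤ ∣ i ℤ.- j ∣ + ∣ j ℤ.- k ∣) (ℤ.+-minus-telescope i j k)
    (ℤ.∣i+j∣≤∣i∣+∣j∣ (i ℤ.- j) (j ℤ.- k))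

lipschitz-walk : ∀ F → Lipschitz F → ∀ {S u v n} → Walk S u v n → ∣ F u ℤ.- F v ∣ ≤ n
lipschitz-walk F _ {u = u} here = ℕ.≤-reflexive (cong ∣_∣ (ℤ.+-inverseʳ (F u)))
lipschitz-walk F lip {S} {u} {v} (step {w = w} e walk) = ℕ.≤-trans (∣i-k∣≤∣i-j∣+∣j-k∣ (F u) (F w) (F v))
  (ℕ.+-mono-≤ (lip u w (edge-adj S u w e)) (lipschitz-walk F lip walk))

Spread : (Point → ℤ) → ℕ → List Point → Set
Spread F D xs = ∀ {u v} → u ∈ xs → v ∈ xs → ∣ F u ℤ.- F v ∣ ≤ D

diameter⇒spread : ∀ F → Lipschitz F → ∀ {S D} → DiameterAtMost S D → Spread F D (verts S)
diameter⇒spread F lip diam u∈ v∈ with n , n≤D , walk ← diam _ _ u∈ v∈ = ℕ.≤-trans (lipschitz-walk F lip walk) n≤D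

module Offset (F : Point → ℤ) (v₀ : Point) (vs : List Point) where
  open ℤ-Extrema using (argmin; argmin-sel; f[argmin]≤f[⊤]; f[argmin]≤f[xs])

  lowest : Point
  lowest = argmin F v₀ vs

  lowest-∈ : lowest ∈ v₀ ∷ vs
  lowest-∈ with argmin-sel F v₀ vs
  ... | inj₁ lowest≡v₀ = here lowest≡v₀
  ... | inj₂ lowest∈vs = there lowest∈vs

  lowest-≤ : ∀ {v} → v ∈ v₀ ∷ vs → F lowest ℤ.≤ F v
  lowest-≤ (here refl) = f[argmin]≤f[⊤] {f = F} v₀ vs
  lowest-≤ (there v∈vs) = All.lookup (f[argmin]≤f[xs] {f = F} v₀ vs) v∈vs

  offset : Point → ℕ
  offset v = ∣ F lowest ℤ.- F v ∣

  +offset : ∀ {v} → v ∈ v₀ ∷ vs → + offset v ≡ F v ℤ.- F lowest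
  +offset v∈ = ℤ.∣-∣-≤ (lowest-≤ v∈)

  offset-≤ : ∀ {D v} → Spread F D (v₀ ∷ vs) → v ∈ v₀ ∷ vs → offset v ≤ D
  offset-≤ spread v∈ = spread lowest-∈ v∈

  offset-injective : ∀ {u v} → u ∈ v₀ ∷ vs → v ∈ v₀ ∷ vs → offset u ≡ offset v → F u ≡ F v
  offset-injective {u} {v} u∈ v∈ eq = begin
    F u                             ≡⟨ shift (F u) (F lowest) ⟩
    (F u ℤ.- F lowest) ℤ.+ F lowest ≡⟨ cong (ℤ._+ F lowest) (+offset u∈) ⟨
    + offset u ℤ.+ F lowest         ≡⟨ cong (λ o → + o ℤ.+ F lowest) eq ⟩
    + offset v ℤ.+ F lowest         ≡⟨ cong (ℤ._+ F lowest) (+offset v∈) ⟩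
    (F v ℤ.- F lowest) ℤ.+ F lowest ≡⟨ shift (F v) (F lowest) ⟨
    F v                             ∎
    where
    open ≡-Reasoning
    shift : ∀ i j → i ≡ (i ℤ.- j) ℤ.+ j
    shift = ℤ-Solver.solve-∀

spread⇒length-≤ : ∀ {D M} → BoxEncoding D M → ∀ xs → Unique xs →
  Spread diag⁺ D xs → Spread diag⁻ D xs → length xs ≤ M
spread⇒length-≤ _ [] _ _ _ = z≤n
spread⇒length-≤ {D} {M} enc (v₀ ∷ vs) uniq spread⁺ spread⁻ =
  injectionBelow⇒length-≤ (code ∘ corner) M uniq (code-< ∘ corner-∈) λ u∈ v∈ eq →
    diagonals-injective (O⁺.offset-injective u∈ v∈ (cong proj₁ (code-injective (corner-∈ u∈) (corner-∈ v∈) eq)))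
                        (O⁻.offset-injective u∈ v∈ (cong proj₂ (code-injective (corner-∈ u∈) (corner-∈ v∈) eq)))
  where
  open BoxEncoding enc
  module O⁺ = Offset diag⁺ v₀ vs
  module O⁻ = Offset diag⁻ v₀ vs

  corner : Point → ℕ × ℕ
  corner v = O⁺.offset v , O⁻.offset v

  -- (x + y − a) + (x − y − b) = 2x − (a + b)
  corner-parity : ∀ {v} → v ∈ v₀ ∷ vs → parity (O⁺.offset v + O⁻.offset v) ≡ parity (O⁺.offset v₀ + O⁻.offset v₀)
  corner-parity {v@(x , y)} v∈ = parity-cong-ℤ _ _ (x ℤ.- proj₁ v₀) (begin
    + O⁺.offset v ℤ.+ + O⁻.offset v    ≡⟨ cong₂ ℤ._+_ (O⁺.+offset v∈) (O⁻.+offset v∈) ⟩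
    (diag⁺ v ℤ.- a) ℤ.+ (diag⁻ v ℤ.- b)  ≡⟨ shift x y (proj₁ v₀) (proj₂ v₀) a b ⟩
    ((diag⁺ v₀ ℤ.- a) ℤ.+ (diag⁻ v₀ ℤ.- b)) ℤ.+ ((x ℤ.- proj₁ v₀) ℤ.+ (x ℤ.- proj₁ v₀))
      ≡⟨ cong₂ (λ s t → (s ℤ.+ t) ℤ.+ _) (O⁺.+offset (here refl)) (O⁻.+offset (here refl)) ⟨
    (+ O⁺.offset v₀ ℤ.+ + O⁻.offset v₀) ℤ.+ ((x ℤ.- proj₁ v₀) ℤ.+ (x ℤ.- proj₁ v₀)) ∎)
    where
    open ≡-Reasoning
    a = diag⁺ O⁺.lowest
    b = diag⁻ O⁻.lowest
    shift : ∀ x y x₀ y₀ a b → ((x ℤ.+ y) ℤ.- a) ℤ.+ ((x ℤ.- y) ℤ.- b)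
          ≡ (((x₀ ℤ.+ y₀) ℤ.- a) ℤ.+ ((x₀ ℤ.- y₀) ℤ.- b)) ℤ.+ ((x ℤ.- x₀) ℤ.+ (x ℤ.- x₀))
    shift = ℤ-Solver.solve-∀

  corner-∈ : ∀ {v} → v ∈ v₀ ∷ vs → ParityBox D (parity (O⁺.offset v₀ + O⁻.offset v₀)) (corner v)
  corner-∈ v∈ = O⁺.offset-≤ spread⁺ v∈ , O⁻.offset-≤ spread⁻ v∈ , corner-parity v∈

upperBound : ∀ {D M} → BoxEncoding D M → AtMostN D M
upperBound enc S (_ , _ , diam) = spread⇒length-≤ enc (verts S) (uniq S)
  (diameter⇒spread diag⁺ diag⁺-lipschitz diam) (diameter⇒spread diag⁻ diag⁻-lipschitz diam)

-- Trees given by parent pointers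

_≟ᴾ_ : DecidableEquality Point
_≟ᴾ_ = ≡-dec ℤ._≟_ ℤ._≟_

does⇒ : ∀ {A : Set} (a? : Dec A) → does a? ≡ true → A
does⇒ (yes a) _ = a

Adjacent-sym : ∀ u v → Adjacent u v → Adjacent v u
Adjacent-sym (x , y) (x′ , y′) adj rewrite ℤ.∣i-j∣≡∣j-i∣ x′ x | ℤ.∣i-j∣≡∣j-i∣ y′ y = adj

horizontal-Adjacent : ∀ x x′ y → ∣ x ℤ.- x′ ∣ ≡ 1 → Adjacent (x , y) (x′ , y)
horizontal-Adjacent x x′ y eq rewrite ℤ.+-inverseʳ y | ℕ.+-identityʳ ∣ x ℤ.- x′ ∣ = eq

vertical-Adjacent : ∀ x y y′ → ∣ y ℤ.- y′ ∣ ≡ 1 → Adjacent (x , y) (x , y′)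
vertical-Adjacent x y y′ eq rewrite ℤ.+-inverseʳ x = eq

∣i-[i+1]∣≡1 : ∀ i → ∣ i ℤ.- (i ℤ.+ ℤ.1ℤ) ∣ ≡ 1
∣i-[i+1]∣≡1 i = cong ∣_∣ (diff i)
  where
  diff : ∀ i → i ℤ.- (i ℤ.+ ℤ.1ℤ) ≡ ℤ.-1ℤ
  diff = ℤ-Solver.solve-∀

∣i-[i-1]∣≡1 : ∀ i → ∣ i ℤ.- (i ℤ.- ℤ.1ℤ) ∣ ≡ 1
∣i-[i-1]∣≡1 i = cong ∣_∣ (diff i)
  where
  diff : ∀ i → i ℤ.- (i ℤ.- ℤ.1ℤ) ≡ ℤ.1ℤ
  diff = ℤ-Solver.solve-∀

meshNeighbour⇒Adjacent : ∀ {v w} → w ∈ meshNeighbours v → Adjacent v w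
meshNeighbour⇒Adjacent {x , y} (here refl) = horizontal-Adjacent x _ y (∣i-[i+1]∣≡1 x)
meshNeighbour⇒Adjacent {x , y} (there (here refl)) = horizontal-Adjacent x _ y (∣i-[i-1]∣≡1 x)
meshNeighbour⇒Adjacent {x , y} (there (there (here refl))) = vertical-Adjacent x y _ (∣i-[i+1]∣≡1 y)
meshNeighbour⇒Adjacent {x , y} (there (there (there (here refl)))) = vertical-Adjacent x y _ (∣i-[i-1]∣≡1 y)

module _ {S : MeshSubgraph} where

  infixr 5 _++ʷ_
  _++ʷ_ : ∀ {u w v k l} → Walk S u w k → Walk S w v l → Walk S u v (k + l)
  here ++ʷ q = q
  step e p ++ʷ q = step e (p ++ʷ q)

  reverseʷ : ∀ {u v k} → Walk S u v k → Walk S v u k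
  reverseʷ here = here
  reverseʷ {u} {v} {suc k} (step {w = w} e p) =
    subst (Walk S v u) (ℕ.+-comm k 1) (reverseʷ p ++ʷ step (trans (edge-sym S w u) e) here)

module ParentGraph (parent : Point → Point) (isRoot : Point → Bool)
  (parent-adjacent : ∀ v → isRoot v ≡ false → Adjacent (parent v) v) where

  ParentOf : Point → Point → Set
  ParentOf u v = isRoot v ≡ false × parent v ≡ u

  parentOf? : ∀ u v → Dec (ParentOf u v)
  parentOf? u v = (isRoot v Bool.≟ false) ×-dec (parent v ≟ᴾ u)

  TreeEdge : List Point → Point → Point → Set
  TreeEdge V u v = (ParentOf u v ⊎ ParentOf v u) × u ∈ V × v ∈ V

  treeEdge? : ∀ V u v → Dec (TreeEdge V u v)
  treeEdge? V u v = (parentOf? u v ⊎-dec parentOf? v u) ×-dec (u ∈? V) ×-dec (v ∈? V)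
    where open DecMembership _≟ᴾ_ using (_∈?_)

  TreeEdge-sym : ∀ {V u v} → TreeEdge V u v → TreeEdge V v u
  TreeEdge-sym (p , u∈ , v∈) = Sum.swap p , v∈ , u∈

  ParentOf⇒Adjacent : ∀ {u v} → ParentOf u v → Adjacent u v
  ParentOf⇒Adjacent {v = v} (notRoot , refl) = parent-adjacent v notRoot

  tree : (V : List Point) → Unique V → MeshSubgraph
  tree V uniq = record
    { verts    = V
    ; uniq     = uniq
    ; edge     = λ u v → does (treeEdge? V u v)
    ; edge-sym = λ u v → does-⇔ (mk⇔ TreeEdge-sym TreeEdge-sym) (treeEdge? V u v) (treeEdge? V v u)
    ; edge-adj = λ u v e → [ ParentOf⇒Adjacent , Adjacent-sym v u ∘ ParentOf⇒Adjacent ]′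
                             (proj₁ (does⇒ (treeEdge? V u v) e))
    ; edge-mem = λ u v e → proj₂ (does⇒ (treeEdge? V u v) e)
    }

  SpareNeighbour : Point → Set
  SpareNeighbour v = Σ Point λ w → w ∈ meshNeighbours v × ¬ ParentOf v w × ¬ ParentOf w v

  tree-degree≤3 : (∀ v → SpareNeighbour v) → ∀ V uniq → MaxDegreeAtMost (tree V uniq) 3
  tree-degree≤3 spare V uniq v _ with w , w∈ , ¬vw , ¬wv ← spare v =
    ℕ.≤-pred (filter-notAll (T? ∘ edge? v) (meshNeighbours v) (Any.map (λ { refl → not-edge }) w∈))
    where
    edge? = λ u w → does (treeEdge? V u w)
    not-edge : ¬ T (edge? v w)
    not-edge = subst T (dec-false (treeEdge? V v w) λ (p , _) → [ ¬vw , ¬wv ]′ p)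

  climb : ∀ {V uniq c p v l} → isRoot c ≡ false → c ∈ V → parent c ≡ p → p ∈ V →
    Walk (tree V uniq) p v l → Walk (tree V uniq) c v (suc l)
  climb {V} {c = c} {p} notRoot c∈ parent≡p p∈ =
    step (dec-true (treeEdge? V c p) (inj₂ (notRoot , parent≡p) , c∈ , p∈))

-- The double comb and the lower bound

origin hub : Point
origin = (+ 0 , + 0)
hub = (+ 1 , + 0)

isOrigin : Point → Bool
isOrigin (+ 0 , + 0) = true
isOrigin _ = false

-- Columns 0 and 1 lead to the origin and the hub, rows y ≠ 0 lead to these columns.  The points
-- (x , 0) other than the origin and the hub are never vertices; their parent is just some neighbour.
combParent : Point → Point
combParent (+ 1 , + 0) = origin
combParent (x , + 0) = (x , + 1)
combParent (+ 0 , + suc a) = (+ 0 , + a)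
combParent (+ 1 , + suc a) = (+ 1 , + a)
combParent (+ suc (suc k) , + suc a) = (+ suc k , + suc a)
combParent (-[1+ k ] , + suc a) = (ℤ.- (+ k) , + suc a)
combParent (+ 0 , -[1+ a ]) = (+ 0 , ℤ.- (+ a))
combParent (+ 1 , -[1+ a ]) = (+ 1 , ℤ.- (+ a))
combParent (+ suc (suc k) , -[1+ a ]) = (+ suc k , -[1+ a ])
combParent (-[1+ k ] , -[1+ a ]) = (ℤ.- (+ k) , -[1+ a ])

-[1+i]+1≡-i : ∀ i → -[1+ i ] ℤ.+ ℤ.1ℤ ≡ ℤ.- (+ i)
-[1+i]+1≡-i zero = refl
-[1+i]+1≡-i (suc i) = refl

combParent-∈ : ∀ v → isOrigin v ≡ false → combParent v ∈ meshNeighbours v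
combParent-∈ (+ 1 , + 0) _ = there (here refl)
combParent-∈ (+ suc (suc k) , + 0) _ = there (there (here refl))
combParent-∈ (-[1+ k ] , + 0) _ = there (there (here refl))
combParent-∈ (+ 0 , + suc a) _ = there (there (there (here refl)))
combParent-∈ (+ 1 , + suc a) _ = there (there (there (here refl)))
combParent-∈ (+ suc (suc k) , + suc a) _ = there (here refl)
combParent-∈ (-[1+ k ] , + suc a) _ = here (cong (_, + suc a) (sym (-[1+i]+1≡-i k)))
combParent-∈ (+ 0 , -[1+ a ]) _ = there (there (here (cong (+ 0 ,_) (sym (-[1+i]+1≡-i a)))))
combParent-∈ (+ 1 , -[1+ a ]) _ = there (there (here (cong (+ 1 ,_) (sym (-[1+i]+1≡-i a)))))
combParent-∈ (+ suc (suc k) , -[1+ a ]) _ = there (here refl)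
combParent-∈ (-[1+ k ] , -[1+ a ]) _ = here (cong (_, -[1+ a ]) (sym (-[1+i]+1≡-i k)))

open ParentGraph combParent isOrigin
  (λ v notOrigin → Adjacent-sym v _ (meshNeighbour⇒Adjacent (combParent-∈ v notOrigin)))

+[1+k]≢+[2+k] : ∀ k → + suc k ≢ + suc (suc k)
+[1+k]≢+[2+k] k eq = ℕ.1+n≢n (sym (ℤ.+-injective eq))

-k≢-[1+k] : ∀ k → ℤ.- (+ k) ≢ -[1+ k ]
-k≢-[1+k] zero ()
-k≢-[1+k] (suc k) eq = ℕ.1+n≢n (sym (ℤ.-[1+-injective eq))

differentColumn : ∀ {u v} → proj₁ (combParent v) ≢ proj₁ u → ¬ ParentOf u v
differentColumn ne (_ , refl) = ne refl

spareVerticalNeighbour : ∀ v w → w ∈ meshNeighbours v →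
  proj₁ (combParent w) ≢ proj₁ v → proj₁ (combParent v) ≢ proj₁ w → SpareNeighbour v
spareVerticalNeighbour v w w∈ ne₁ ne₂ = w , w∈ , differentColumn ne₁ , differentColumn ne₂

combSpare : ∀ v → SpareNeighbour v
combSpare (+ 0 , + 0) = _ , there (here refl) , (λ { (_ , ()) }) , λ { (() , _) }
combSpare (+ 1 , + 0) = _ , here refl , (λ { (_ , ()) }) , λ { (_ , ()) }
combSpare (+ suc (suc k) , + 0) = _ , here refl , (λ { (_ , ()) }) , λ { (_ , ()) }
combSpare (-[1+ k ] , + 0) = _ , there (here refl) , (λ { (_ , ()) }) , λ { (_ , ()) }
combSpare (+ 0 , + suc a) = _ , here refl , (λ { (_ , ()) }) , λ { (_ , ()) }
combSpare (+ 1 , + suc a) = _ , there (here refl) , (λ { (_ , ()) }) , λ { (_ , ()) }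
combSpare v@(+ suc (suc k) , + suc a) =
  spareVerticalNeighbour v _ (there (there (here refl))) (+[1+k]≢+[2+k] k) (+[1+k]≢+[2+k] k)
combSpare v@(-[1+ k ] , + suc a) =
  spareVerticalNeighbour v _ (there (there (here refl))) (-k≢-[1+k] k) (-k≢-[1+k] k)
combSpare (+ 0 , -[1+ a ]) = _ , here refl , (λ { (_ , ()) }) , λ { (_ , ()) }
combSpare (+ 1 , -[1+ a ]) = _ , there (here refl) , (λ { (_ , ()) }) , λ { (_ , ()) }
combSpare v@(+ suc (suc k) , -[1+ a ]) =
  spareVerticalNeighbour v _ (there (there (there (here refl)))) (+[1+k]≢+[2+k] k) (+[1+k]≢+[2+k] k)
combSpare v@(-[1+ k ] , -[1+ a ]) =
  spareVerticalNeighbour v _ (there (there (there (here refl)))) (-k≢-[1+k] k) (-k≢-[1+k] k)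

firstRow : ℕ → ℕ × ℕ
firstRow k = (0 , k)

nextRow : ℕ × ℕ → ℕ × ℕ
nextRow (a , k) = (suc a , k)

triangle : ℕ → List (ℕ × ℕ)
triangle zero = []
triangle (suc n) = map firstRow (upTo (suc n)) ++ map nextRow (triangle n)

triangle-sound : ∀ n {a k} → (a , k) ∈ triangle n → a + k < n
triangle-sound (suc n) p with ∈-++⁻ (map firstRow (upTo (suc n))) p
... | inj₁ p₀ with _ , k∈ , refl ← ∈-map⁻ firstRow p₀ = ∈-upTo⁻ k∈
... | inj₂ p₁ with _ , c∈ , refl ← ∈-map⁻ nextRow p₁ = s≤s (triangle-sound n c∈)

triangle-complete : ∀ n a k → a + k < n → (a , k) ∈ triangle n
triangle-complete (suc n) zero k k< = ∈-++⁺ˡ (∈-map⁺ firstRow (∈-upTo⁺ k<))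
triangle-complete (suc n) (suc a) k (s≤s a+k<n) =
  ∈-++⁺ʳ (map firstRow (upTo (suc n))) (∈-map⁺ nextRow (triangle-complete n a k a+k<n))

triangle-unique : ∀ n → Unique (triangle n)
triangle-unique zero = []
triangle-unique (suc n) =
  Unique.++⁺ (Unique.map⁺ (cong proj₂) (Unique.upTo⁺ (suc n)))
             (Unique.map⁺ (λ { refl → refl }) (triangle-unique n))
             (disjoint-map λ { k (a , _) () })

triangle-length : ∀ n → length (triangle n) + length (triangle n) ≡ n * suc n
triangle-length zero = refl
triangle-length (suc n) = begin
  length (triangle (suc n)) + length (triangle (suc n))  ≡⟨ cong (λ l → l + l) row-split ⟩
  (suc n + length (triangle n)) + (suc n + length (triangle n))
    ≡⟨ regroup (suc n) (length (triangle n)) ⟩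
  (suc n + suc n) + (length (triangle n) + length (triangle n))
    ≡⟨ cong (λ t → (suc n + suc n) + t) (triangle-length n) ⟩
  (suc n + suc n) + n * suc n                            ≡⟨ total n ⟩
  suc n * suc (suc n)                                    ∎
  where
  open ≡-Reasoning
  row-split : length (triangle (suc n)) ≡ suc n + length (triangle n)
  row-split = trans (length-++ (map firstRow (upTo (suc n))))
    (cong₂ _+_ (trans (length-map firstRow (upTo (suc n))) (length-upTo (suc n)))
               (length-map nextRow (triangle n)))
  regroup : ∀ r t → (r + t) + (r + t) ≡ (r + r) + (t + t)
  regroup = ℕ-Solver.solve-∀
  total : ∀ n → (suc n + suc n) + n * suc n ≡ suc n * suc (suc n)
  total = ℕ-Solver.solve-∀

data Side : Set where
  left right : Side

data Half : Set where
  upper lower : Half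

column : Side → ℕ → ℤ
column left k = ℤ.- (+ k)
column right k = + suc k

row : Half → ℕ → ℤ
row upper a = + suc a
row lower a = -[1+ a ]

-- The point k steps along the branch of side s in row ±(a + 1); its tree distance to
-- centre s is a + k + 1.
branchPoint : Side → Half → ℕ × ℕ → Point
branchPoint s h (a , k) = (column s k , row h a)

centre : Side → Point
centre left = origin
centre right = hub

branchPoint-injective : ∀ s h {c c′} → branchPoint s h c ≡ branchPoint s h c′ → c ≡ c′
branchPoint-injective s h eq =
  cong₂ _,_ (row-injective h (cong proj₂ eq)) (column-injective s (cong proj₁ eq))
  where
  column-injective : ∀ s {k k′} → column s k ≡ column s k′ → k ≡ k′
  column-injective left eq = ℤ.+-injective (ℤ.neg-injective eq)
  column-injective right eq = ℕ.suc-injective (ℤ.+-injective eq)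
  row-injective : ∀ h {a a′} → row h a ≡ row h a′ → a ≡ a′
  row-injective upper eq = ℕ.suc-injective (ℤ.+-injective eq)
  row-injective lower eq = ℤ.-[1+-injective eq

quadrant : Point → Side × Half
quadrant (+ suc _ , + suc _) = right , upper
quadrant (+ suc _ , _) = right , lower
quadrant (_ , + suc _) = left , upper
quadrant (_ , _) = left , lower

quadrant-branchPoint : ∀ s h c → quadrant (branchPoint s h c) ≡ (s , h)
quadrant-branchPoint left upper (a , zero) = refl
quadrant-branchPoint left upper (a , suc k) = refl
quadrant-branchPoint left lower (a , zero) = refl
quadrant-branchPoint left lower (a , suc k) = refl
quadrant-branchPoint right upper (a , k) = refl
quadrant-branchPoint right lower (a , k) = refl

branchPoint-notOrigin : ∀ s h c → isOrigin (branchPoint s h c) ≡ false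
branchPoint-notOrigin left upper (a , zero) = refl
branchPoint-notOrigin left upper (a , suc k) = refl
branchPoint-notOrigin left lower (a , zero) = refl
branchPoint-notOrigin left lower (a , suc k) = refl
branchPoint-notOrigin right upper (a , k) = refl
branchPoint-notOrigin right lower (a , k) = refl

combParent-along : ∀ s h a k → combParent (branchPoint s h (a , suc k)) ≡ branchPoint s h (a , k)
combParent-along left upper a k = refl
combParent-along left lower a k = refl
combParent-along right upper a k = refl
combParent-along right lower a k = refl

combParent-down : ∀ s h a → combParent (branchPoint s h (suc a , 0)) ≡ branchPoint s h (a , 0)
combParent-down left upper a = refl
combParent-down left lower a = refl
combParent-down right upper a = refl
combParent-down right lower a = refl

combParent-centre : ∀ s h → combParent (branchPoint s h (0 , 0)) ≡ centre s
combParent-centre left upper = refl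
combParent-centre left lower = refl
combParent-centre right upper = refl
combParent-centre right lower = refl

quadrants : List (Side × Half)
quadrants = (left , upper) ∷ (left , lower) ∷ (right , upper) ∷ (right , lower) ∷ []

quadrants-complete : ∀ q → q ∈ quadrants
quadrants-complete (left , upper) = here refl
quadrants-complete (left , lower) = there (here refl)
quadrants-complete (right , upper) = there (there (here refl))
quadrants-complete (right , lower) = there (there (there (here refl)))

quadrants-unique : Unique quadrants
quadrants-unique = ((λ ()) ∷ (λ ()) ∷ (λ ()) ∷ []) ∷ ((λ ()) ∷ (λ ()) ∷ []) ∷ ((λ ()) ∷ []) ∷ [] ∷ []

module DoubleComb (m n : ℕ) where

  radius : Side → ℕ
  radius left = m
  radius right = n

  branch : Side × Half → List Point
  branch (s , h) = map (branchPoint s h) (triangle (radius s))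

  branches : List Point
  branches = concatMap branch quadrants

  vertices : List Point
  vertices = origin ∷ hub ∷ branches

  branches⁻ : ∀ {v} → v ∈ branches →
    Σ Side λ s → Σ Half λ h → Σ (ℕ × ℕ) λ c → c ∈ triangle (radius s) × v ≡ branchPoint s h c
  branches⁻ v∈
    with (s , h) , v∈′ ← Any.satisfied {xs = quadrants} (Any.map⁻ (∈-concat⁻ (map branch quadrants) v∈))
    with c , c∈ , eq ← ∈-map⁻ (branchPoint s h) v∈′ = s , h , c , c∈ , eq

  branches⁺ : ∀ s h {c} → c ∈ triangle (radius s) → branchPoint s h c ∈ branches
  branches⁺ s h c∈ =
    ∈-concat⁺′ (∈-map⁺ (branchPoint s h) c∈) (∈-map⁺ branch (quadrants-complete (s , h)))

  branches-offAxis : ∀ {v} → v ∈ branches → proj₂ v ≢ + 0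
  branches-offAxis v∈ with branches⁻ v∈
  ... | _ , upper , _ , _ , refl = λ ()
  ... | _ , lower , _ , _ , refl = λ ()

  branch-disjoint : ∀ {q q′} → q ≢ q′ → Disjoint (branch q) (branch q′)
  branch-disjoint {s , h} {s′ , h′} ne (p , p′)
    with c , _ , refl ← ∈-map⁻ (branchPoint s h) p | c′ , _ , eq ← ∈-map⁻ (branchPoint s′ h′) p′ =
    ne (trans (sym (quadrant-branchPoint s h c)) (trans (cong quadrant eq) (quadrant-branchPoint s′ h′ c′)))

  branches-unique : Unique branches
  branches-unique = Unique.concat⁺
    (All.map⁺ {f = branch} (All.tabulate {xs = quadrants} λ { {s , h} _ →
      Unique.map⁺ (branchPoint-injective s h) (triangle-unique (radius s)) }))
    (AllPairs.map⁺ {f = branch} {xs = quadrants} (AllPairs.map branch-disjoint quadrants-unique))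

  vertices-unique : Unique vertices
  vertices-unique = All.tabulate origin∉ ∷ All.tabulate hub∉ ∷ branches-unique
    where
    origin∉ : ∀ {v} → v ∈ hub ∷ branches → origin ≢ v
    origin∉ (here refl) ()
    origin∉ (there v∈) eq = branches-offAxis v∈ (sym (cong proj₂ eq))
    hub∉ : ∀ {v} → v ∈ branches → hub ≢ v
    hub∉ v∈ eq = branches-offAxis v∈ (sym (cong proj₂ eq))

  graph : MeshSubgraph
  graph = tree vertices vertices-unique

  hub-origin : Walk graph hub origin 1
  hub-origin = climb refl (there (here refl)) refl (here refl) here

  centre-∈ : ∀ s → centre s ∈ vertices
  centre-∈ left = here refl
  centre-∈ right = there (here refl)

  branchPoint-∈ : ∀ s h a k → k + a < radius s → branchPoint s h (a , k) ∈ vertices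
  branchPoint-∈ s h a k k+a< = there (there (branches⁺ s h
    (triangle-complete (radius s) a k (subst (_< radius s) (ℕ.+-comm k a) k+a<))))

  walkToCentre : ∀ s h a k → k + a < radius s → Walk graph (branchPoint s h (a , k)) (centre s) (suc (k + a))
  walkToCentre s h a (suc k) k+a< = climb (branchPoint-notOrigin s h _) (branchPoint-∈ s h a (suc k) k+a<)
    (combParent-along s h a k) (branchPoint-∈ s h a k (ℕ.<⇒≤ k+a<)) (walkToCentre s h a k (ℕ.<⇒≤ k+a<))
  walkToCentre s h (suc a) zero a< = climb (branchPoint-notOrigin s h _) (branchPoint-∈ s h (suc a) 0 a<)
    (combParent-down s h a) (branchPoint-∈ s h a 0 (ℕ.<⇒≤ a<)) (walkToCentre s h a 0 (ℕ.<⇒≤ a<))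
  walkToCentre s h zero zero 0< = climb (branchPoint-notOrigin s h _) (branchPoint-∈ s h 0 0 0<)
    (combParent-centre s h) (centre-∈ s) here

  nearCentre : ∀ {u} → u ∈ vertices → Σ Side λ s → Σ ℕ λ l → l ≤ radius s × Walk graph u (centre s) l
  nearCentre (here refl) = left , 0 , z≤n , here
  nearCentre (there (here refl)) = right , 0 , z≤n , here
  nearCentre (there (there u∈)) with s , h , (a , k) , c∈ , refl ← branches⁻ u∈ =
    s , suc (k + a) , k+a< , walkToCentre s h a k k+a<
    where
    k+a< = subst (_< radius s) (ℕ.+-comm a k) (triangle-sound (radius s) c∈)

  gap : Side → Side → ℕ
  gap left left = 0
  gap right right = 0
  gap _ _ = 1

  centreWalk : ∀ s s′ → Walk graph (centre s) (centre s′) (gap s s′)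
  centreWalk left left = here
  centreWalk right right = here
  centreWalk left right = reverseʷ hub-origin
  centreWalk right left = hub-origin

  diameter : ∀ {D} → (∀ s s′ → radius s + (gap s s′ + radius s′) ≤ D) → DiameterAtMost graph D
  diameter bound u v u∈ v∈ with s , l₁ , l₁≤ , w₁ ← nearCentre u∈ | s′ , l₂ , l₂≤ , w₂ ← nearCentre v∈ =
    l₁ + (gap s s′ + l₂) ,
    ℕ.≤-trans (ℕ.+-mono-≤ l₁≤ (ℕ.+-monoʳ-≤ (gap s s′) l₂≤)) (bound s s′) ,
    w₁ ++ʷ centreWalk s s′ ++ʷ reverseʷ w₂

  admissible : ∀ {D} → (∀ s s′ → radius s + (gap s s′ + radius s′) ≤ D) → Admissible D graph
  admissible bound =
    (λ u v u∈ v∈ → let l , _ , walk = diameter bound u v u∈ v∈ in l , walk) ,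
    tree-degree≤3 combSpare vertices vertices-unique ,
    diameter bound

  size-graph : size graph ≡ 2 + (m * suc m + n * suc n)
  size-graph = cong (λ l → 2 + l) (begin
    length branches                                ≡⟨ length-concat (map branch quadrants) ⟩
    length (branch (left , upper)) + (length (branch (left , lower)) +
      (length (branch (right , upper)) + (length (branch (right , lower)) + 0)))
      ≡⟨ cong₂ _+_ (branch-length (left , upper)) (cong₂ _+_ (branch-length (left , lower))
         (cong₂ _+_ (branch-length (right , upper)) (cong (_+ 0) (branch-length (right , lower))))) ⟩
    Tm + (Tm + (Tn + (Tn + 0)))                    ≡⟨ regroup Tm Tn ⟩
    (Tm + Tm) + (Tn + Tn)                          ≡⟨ cong₂ _+_ (triangle-length m) (triangle-length n) ⟩
    m * suc m + n * suc n                          ∎)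
    where
    open ≡-Reasoning
    branch-length : ∀ q → length (branch q) ≡ length (triangle (radius (proj₁ q)))
    branch-length (s , h) = length-map (branchPoint s h) (triangle (radius s))
    Tm = length (triangle m)
    Tn = length (triangle n)
    regroup : ∀ a b → a + (a + (b + (b + 0))) ≡ (a + a) + (b + b)
    regroup = ℕ-Solver.solve-∀

atLeast-doubleComb : ∀ {D k} m n → m + m ≤ D → n + n ≤ D → suc (m + n) ≤ D →
  k ≤ 2 + (m * suc m + n * suc n) → AtLeastN D k
atLeast-doubleComb {D} {k} m n m+m≤D n+n≤D 1+m+n≤D k≤ =
  graph , admissible bound , subst (k ≤_) (sym size-graph) k≤
  where
  open DoubleComb m n
  bound : ∀ s s′ → radius s + (gap s s′ + radius s′) ≤ D
  bound left left = m+m≤D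
  bound right right = n+n≤D
  bound left right = subst (_≤ D) (sym (ℕ.+-suc m n)) 1+m+n≤D
  bound right left = subst (_≤ D) (sym (trans (ℕ.+-suc n m) (cong suc (ℕ.+-comm n m)))) 1+m+n≤D

atLeast-origin : AtLeastN 0 1
atLeast-origin = tree (origin ∷ []) ([] ∷ []) , admissible , s≤s z≤n
  where
  walk : ∀ u v → u ∈ origin ∷ [] → v ∈ origin ∷ [] → Walk (tree (origin ∷ []) ([] ∷ [])) u v 0
  walk u v (here refl) (here refl) = here
  admissible : Admissible 0 (tree (origin ∷ []) ([] ∷ []))
  admissible =
    (λ u v u∈ v∈ → 0 , walk u v u∈ v∈) ,
    tree-degree≤3 combSpare (origin ∷ []) ([] ∷ []) ,
    λ u v u∈ v∈ → 0 , z≤n , walk u v u∈ v∈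

lowerBound-even : ∀ p → AtLeastN (2 * p) (2 * p * p ∸ 2 * p + 1)
lowerBound-even zero = atLeast-origin
lowerBound-even (suc q) = atLeast-doubleComb (suc q) q
  (m+k≡n⇒m≤n 0 (e₁ q)) (m+k≡n⇒m≤n 2 (e₂ q)) (m+k≡n⇒m≤n 0 (e₃ q))
  (ℕ.≤-trans (ℕ.+-monoˡ-≤ 1 (ℕ.m∸n≤m (2 * suc q * suc q) (2 * suc q))) (m+k≡n⇒m≤n 1 (e₄ q)))
  where
  e₁ : ∀ q → suc q + suc q + 0 ≡ 2 * suc q
  e₁ = ℕ-Solver.solve-∀
  e₂ : ∀ q → q + q + 2 ≡ 2 * suc q
  e₂ = ℕ-Solver.solve-∀
  e₃ : ∀ q → suc (suc q + q) + 0 ≡ 2 * suc q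
  e₃ = ℕ-Solver.solve-∀
  e₄ : ∀ q → 2 * suc q * suc q + 1 + 1 ≡ 2 + (suc q * suc (suc q) + q * suc q)
  e₄ = ℕ-Solver.solve-∀

lowerBound-4r+1 : ∀ r → AtLeastN (4 * r + 1) (8 * r * r + 2 * r)
lowerBound-4r+1 r = atLeast-doubleComb (2 * r) (2 * r)
  (m+k≡n⇒m≤n 1 (e₁ r)) (m+k≡n⇒m≤n 1 (e₁ r)) (m+k≡n⇒m≤n 0 (e₂ r)) (m+k≡n⇒m≤n (2 * r + 2) (e₃ r))
  where
  e₁ : ∀ r → 2 * r + 2 * r + 1 ≡ 4 * r + 1
  e₁ = ℕ-Solver.solve-∀
  e₂ : ∀ r → suc (2 * r + 2 * r) + 0 ≡ 4 * r + 1
  e₂ = ℕ-Solver.solve-∀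
  e₃ : ∀ r → 8 * r * r + 2 * r + (2 * r + 2) ≡ 2 + (2 * r * suc (2 * r) + 2 * r * suc (2 * r))
  e₃ = ℕ-Solver.solve-∀

lowerBound-4r+3 : ∀ r → AtLeastN (4 * r + 3) (8 * r * r + 10 * r + 6)
lowerBound-4r+3 r = atLeast-doubleComb (2 * r + 1) (2 * r + 1)
  (m+k≡n⇒m≤n 1 (e₁ r)) (m+k≡n⇒m≤n 1 (e₁ r)) (m+k≡n⇒m≤n 0 (e₂ r)) (m+k≡n⇒m≤n (2 * r) (e₃ r))
  where
  e₁ : ∀ r → 2 * r + 1 + (2 * r + 1) + 1 ≡ 4 * r + 3
  e₁ = ℕ-Solver.solve-∀
  e₂ : ∀ r → suc (2 * r + 1 + (2 * r + 1)) + 0 ≡ 4 * r + 3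
  e₂ = ℕ-Solver.solve-∀
  e₃ : ∀ r → 8 * r * r + 10 * r + 6 + 2 * r ≡ 2 + ((2 * r + 1) * suc (2 * r + 1) + (2 * r + 1) * suc (2 * r + 1))
  e₃ = ℕ-Solver.solve-∀

theorem4 :
    (∀ (p : ℕ) →
        AtLeastN (2 * p) (2 * p * p ∸ 2 * p + 1)
      × AtMostN (2 * p) (2 * p * p + 2 * p + 1))
    × (∀ (r : ℕ) →
        AtLeastN (4 * r + 1) (8 * r * r + 2 * r)
      × AtMostN (4 * r + 1) (2 * (2 * r) * (2 * r) + 4 * (2 * r) + 2))
    × (∀ (r : ℕ) →
        AtLeastN (4 * r + 3) (8 * r * r + 10 * r + 6)
      × AtMostN (4 * r + 3) (2 * (2 * r + 1) * (2 * r + 1) + 4 * (2 * r + 1) + 2))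
theorem4 =
  (λ p → lowerBound-even p , upperBound (evenBoxEncoding p)) ,
  (λ r → lowerBound-4r+1 r , subst (flip AtMostN _) (diameter₁ r) (upperBound (oddBoxEncoding (2 * r)))) ,
  (λ r → lowerBound-4r+3 r , subst (flip AtMostN _) (diameter₃ r) (upperBound (oddBoxEncoding (2 * r + 1))))
  where
  diameter₁ : ∀ r → suc (2 * (2 * r)) ≡ 4 * r + 1
  diameter₁ = ℕ-Solver.solve-∀
  diameter₃ : ∀ r → suc (2 * (2 * r + 1)) ≡ 4 * r + 3
  diameter₃ = ℕ-Solver.solve-∀
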